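{- Let $e\geq 2$ be an integer. Let $K$ be a finite commutative ring with identity having a unique non-trivial ideal $J=\langle r\rangle$ such that $K/J\cong\mathbb{F}_q$ for a prime power $q$. Then $Y(2e,K)$ is regular of degree $q^{4e-3}-q^{2e-2}$.
   Context: A non-trivial ideal is one different from $\{0\}$ and $K$. Let $K^\times$ be the set of units of $K$. Let $V'$ be the set of tuples $(a_1,\ldots,a_{2e})\in K^{2e}$ having at least one entry in $K^\times$. Two tuples $a,b\in V'$ are equivalent if $a=\lambda b$ for some $\lambda\in K^\times$; write $[a]$ for the class of $a$ and let $V$ be the set of classes. For $a,b\in K^{2e}$ put $\langle a,b\rangle=\sum_{i=1}^{e}(a_ib_{e+i}-a_{e+i}b_i)$. The graph $Y(2e,K)$ has vertex set $V$, with $[a]$ adjacent to $[b]$ iff $\langle a,b\rangle\in J\setminus\{0\}$. -}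

module Defs where

open import Level using (0ℓ)
open import Algebra.Bundles using (CommutativeRing)
open import Data.Nat using (ℕ; zero; suc; _≥_)
import Data.Nat as N
import Data.Fin as Fin
open import Data.Nat.Primality using (Prime)
open import Data.Fin using (Fin; _↑ˡ_; _↑ʳ_)
open import Data.List using (List; length)
open import Data.List.Relation.Unary.All using (All)
open import Data.List.Relation.Unary.Any using (Any)
open import Data.List.Relation.Unary.AllPairs using (AllPairs)
open import Data.Product using (Σ; ∃; _×_; _,_)
open import Data.Sum using (_⊎_)
open import Relation.Nullary using (¬_)
open import Relation.Binary.Definitions using (Decidable)
open import Relation.Binary.PropositionalEquality using (_≡_)

IsPrimePower : ℕ → Set
IsPrimePower q = Σ ℕ λ p → Σ ℕ λ k → Prime p × k ≥ 1 × q ≡ p N.^ k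

module _ (K : CommutativeRing 0ℓ 0ℓ) where
  open CommutativeRing K

  IsFinite : Set
  IsFinite = Σ (List Carrier) λ xs → ∀ x → Any (λ y → x ≈ y) xs

  record IsIdeal (I : Carrier → Set) : Set where
    field
      resp   : ∀ {x y} → x ≈ y → I x → I y
      zero∈  : I 0#
      +-closed : ∀ {x y} → I x → I y → I (x + y)
      *-closed : ∀ a {x} → I x → I (a * x)

  ⟨_⟩ : Carrier → Carrier → Set
  ⟨ r ⟩ x = ∃ λ y → x ≈ y * r

  IsZeroIdeal : (Carrier → Set) → Set
  IsZeroIdeal I = ∀ x → (I x → x ≈ 0#) × (x ≈ 0# → I x)

  IsWholeRing : (Carrier → Set) → Set
  IsWholeRing I = ∀ x → I x

  SameSet : (Carrier → Set) → (Carrier → Set) → Set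
  SameSet I J = ∀ x → (I x → J x) × (J x → I x)

  IsNonTrivialIdeal : (Carrier → Set) → Set
  IsNonTrivialIdeal I = IsIdeal I × ¬ IsZeroIdeal I × ¬ IsWholeRing I

  UniqueNonTrivialIdeal : (Carrier → Set) → Set₁
  UniqueNonTrivialIdeal J =
    IsNonTrivialIdeal J × (∀ (I : Carrier → Set) → IsNonTrivialIdeal I → SameSet I J)

  -- the quotient K/J has exactly q elements: a list of q pairwise
  -- incongruent representatives covering every coset
  QuotientSize : (Carrier → Set) → ℕ → Set
  QuotientSize J q = Σ (List Carrier) λ xs →
      length xs ≡ q
    × AllPairs (λ x y → ¬ J (x - y)) xs
    × (∀ z → Any (λ x → J (z - x)) xs)

  IsUnit : Carrier → Set
  IsUnit x = ∃ λ y → x * y ≈ 1#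

  ∑ : ∀ n → (Fin n → Carrier) → Carrier
  ∑ zero    f = 0#
  ∑ (suc n) f = f Fin.zero + ∑ n (λ i → f (Fin.suc i))

  Tuple : ℕ → Set
  Tuple n = Fin n → Carrier

  -- ⟨a,b⟩ = Σ_{i=1}^{e} (a_i b_{e+i} - a_{e+i} b_i), tuples indexed by Fin (e N.+ e)
  form : (e : ℕ) → Tuple (e N.+ e) → Tuple (e N.+ e) → Carrier
  form e a b = ∑ e (λ i → (a (i ↑ˡ e) * b (e ↑ʳ i)) - (a (e ↑ʳ i) * b (i ↑ˡ e)))

  InV' : ∀ {n} → Tuple n → Set
  InV' a = ∃ λ i → IsUnit (a i)

  Equiv : ∀ {n} → Tuple n → Tuple n → Set
  Equiv a b = ∃ λ l → IsUnit l × (∀ i → a i ≈ l * b i)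

  Adj : (J : Carrier → Set) (e : ℕ) → Tuple (e N.+ e) → Tuple (e N.+ e) → Set
  Adj J e a b = J (form e a b) × ¬ (form e a b ≈ 0#)

  -- the vertex [a] has exactly d neighbours in Y(2e,K): there is a list of d
  -- pairwise inequivalent representatives of vertices adjacent to [a],
  -- covering every neighbouring class
  HasDegree : (J : Carrier → Set) (e : ℕ) → Tuple (e N.+ e) → ℕ → Set
  HasDegree J e a d = Σ (List (Tuple (e N.+ e))) λ bs →
      length bs ≡ d
    × All (λ b → InV' b × Adj J e a b) bs
    × AllPairs (λ b c → ¬ Equiv b c) bs
    × (∀ b → InV' b → Adj J e a b → Any (λ c → Equiv b c) bs)

  IsRegularOfDegree : (J : Carrier → Set) (e : ℕ) → ℕ → Set
  IsRegularOfDegree J e d = ∀ a → InV' a → HasDegree J e a d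

-- K is local with maximal ideal J = ⟨r⟩ and J² = 0, so multiplication by r identifies K/J
-- with J, K has q² elements and its units are K ∖ J. Fix a vertex [a]; some basis vector
-- e_k has ⟨a , e_k⟩ a unit. A neighbour [b] has ⟨a , b⟩ = y r with y a unit, hence a
-- representative with ⟨a , b⟩ = r, unique up to scaling by 1 + J, and such b are determined
-- by their coordinates off k, which form an arbitrary unimodular tuple of length m = 2e - 1.
-- So the degree D counts unimodular m-tuples up to the free action of 1 + J, a group of
-- order q: q D = q^(2m) - q^m, that is D = q^(4e-3) - q^(2e-2).
module Submission where

open import Defs
open import Level using (Level; 0ℓ)
open import Algebra.Bundles using (CommutativeRing)
import Algebra.Solver.Ring
open import Algebra.Solver.Ring.AlmostCommutativeRing
  using (AlmostCommutativeRing; fromCommutativeRing; _-Raw-AlmostCommutative⟶_)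
open import Data.Nat as ℕ using (ℕ; zero; suc; _^_; _∸_; _≥_; _<_)
import Data.Nat.Properties as ℕ
open import Data.Nat.Tactic.RingSolver using (solve-∀)
open import Data.Integer as ℤ using (ℤ; +_; -[1+_]; _⊖_)
import Data.Integer.Properties as ℤ
open import Data.Sign as Sign using (Sign)
open import Data.Maybe using (Maybe; just; nothing)
open import Data.Fin as Fin using (Fin; zero; suc; _↑ˡ_; _↑ʳ_; splitAt; punchIn; punchOut)
import Data.Fin.Properties as Fin
open import Data.Vec.Functional using (head; tail; insertAt; removeAt) renaming ([] to []ᵥ; _∷_ to _∷ᵥ_)
open import Data.Vec.Functional.Properties using (insertAt-lookup; insertAt-punchIn; insertAt-removeAt)
open import Data.List as List using (List; []; _∷_; _++_; cartesianProductWith; length)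
open import Data.List.Properties using (length-++; length-map; filter-all)
open import Data.List.Relation.Unary.All as All using (All; []; _∷_)
import Data.List.Relation.Unary.All.Properties as All
open import Data.List.Relation.Unary.Any as Any using (Any; here; there)
import Data.List.Relation.Unary.Any.Properties as Any
open import Data.List.Relation.Unary.AllPairs as AllPairs using (AllPairs; []; _∷_)
import Data.List.Relation.Unary.AllPairs.Properties as AllPairs
open import Data.Product using (Σ-syntax; ∃; _×_; _,_; proj₁; proj₂)
open import Data.Sum using (_⊎_; inj₁; inj₂; [_,_]′)
open import Data.Unit using (⊤; tt)
open import Function using (_∘_; id)
open import Relation.Nullary using (¬_; Dec; yes; no; ¬?; contradiction)
open import Relation.Nullary.Decidable using (map′; decidable-stable)
open import Relation.Unary as U using (Pred)
open import Relation.Binary.Definitions using (Decidable)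
open import Relation.Binary.PropositionalEquality as ≡ using (_≡_; _≢_; cong; cong₂; module ≡-Reasoning)

-- Algebra.Solver.Ring normalises coefficients, so it needs a coefficient ring whose
-- equations compute; for an abstract commutative ring we take ℤ, mapped into K.
module IntegerSolver {c ℓ : Level} (K : CommutativeRing c ℓ) where
  open CommutativeRing K
  open import Algebra.Properties.Semiring.Mult.TCOptimised semiring
    using (×-homo-+; ×1-homo-*; 1+×) renaming (_×_ to _×′_)
  open import Algebra.Properties.Ring ring using (-0#≈0#; -‿involutive; -1*x≈-x)
  open import Algebra.Properties.AbelianGroup +-abelianGroup using (⁻¹-∙-comm)
  open import Algebra.Properties.CommutativeSemigroup +-commutativeSemigroup
    renaming (interchange to +-interchange)
  open import Algebra.Properties.CommutativeSemigroup *-commutativeSemigroup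
    renaming (interchange to *-interchange)
  open import Relation.Binary.Reasoning.Setoid setoid

  fromℤ : ℤ → Carrier
  fromℤ (+ n)    = n ×′ 1#
  fromℤ -[1+ n ] = - (suc n ×′ 1#)

  private
    x-y≈[1+x]-[1+y] : ∀ x y → x - y ≈ (1# + x) - (1# + y)
    x-y≈[1+x]-[1+y] x y = begin
      x - y                  ≈⟨ +-identityˡ _ ⟨
      0# + (x - y)           ≈⟨ +-congʳ (-‿inverseʳ 1#) ⟨
      (1# - 1#) + (x - y)    ≈⟨ +-interchange 1# (- 1#) x (- y) ⟩
      (1# + x) + (- 1# - y)  ≈⟨ +-congˡ (⁻¹-∙-comm 1# y) ⟩
      (1# + x) - (1# + y)    ∎

    fromℤ-⊖ : ∀ m n → fromℤ (m ⊖ n) ≈ m ×′ 1# - n ×′ 1#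
    fromℤ-⊖ m       zero    = sym (trans (+-congˡ -0#≈0#) (+-identityʳ _))
    fromℤ-⊖ zero    (suc n) = sym (+-identityˡ _)
    fromℤ-⊖ (suc m) (suc n) = begin
      fromℤ (suc m ⊖ suc n)              ≡⟨ ≡.cong fromℤ (ℤ.[1+m]⊖[1+n]≡m⊖n m n) ⟩
      fromℤ (m ⊖ n)                      ≈⟨ fromℤ-⊖ m n ⟩
      m ×′ 1# - n ×′ 1#                  ≈⟨ x-y≈[1+x]-[1+y] (m ×′ 1#) (n ×′ 1#) ⟩
      (1# + m ×′ 1#) - (1# + n ×′ 1#)    ≈⟨ +-cong (1+× m 1#) (-‿cong (1+× n 1#)) ⟨
      suc m ×′ 1# - suc n ×′ 1#          ∎

    sign : Sign → Carrier
    sign Sign.+ = 1#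
    sign Sign.- = - 1#

    sign-* : ∀ s t → sign (s Sign.* t) ≈ sign s * sign t
    sign-* Sign.+ t      = sym (*-identityˡ _)
    sign-* Sign.- Sign.+ = sym (*-identityʳ _)
    sign-* Sign.- Sign.- = sym (trans (-1*x≈-x _) (-‿involutive 1#))

    fromℤ-◃ : ∀ s n → fromℤ (s ℤ.◃ n) ≈ sign s * (n ×′ 1#)
    fromℤ-◃ s      zero    = sym (zeroʳ _)
    fromℤ-◃ Sign.+ (suc n) = sym (*-identityˡ _)
    fromℤ-◃ Sign.- (suc n) = sym (-1*x≈-x _)

    fromℤ-sign : ∀ i → fromℤ i ≈ sign (ℤ.sign i) * (ℤ.∣ i ∣ ×′ 1#)
    fromℤ-sign (+ n)    = sym (*-identityˡ _)
    fromℤ-sign -[1+ n ] = sym (-1*x≈-x _)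

  fromℤ-+ : ∀ i j → fromℤ (i ℤ.+ j) ≈ fromℤ i + fromℤ j
  fromℤ-+ (+ m)    (+ n)    = ×-homo-+ 1# m n
  fromℤ-+ (+ m)    -[1+ n ] = fromℤ-⊖ m (suc n)
  fromℤ-+ -[1+ m ] (+ n)    = trans (fromℤ-⊖ n (suc m)) (+-comm _ _)
  fromℤ-+ -[1+ m ] -[1+ n ] = begin
    - (suc (suc (m ℕ.+ n)) ×′ 1#)    ≡⟨ ≡.cong (λ k → - (suc k ×′ 1#)) (ℕ.+-suc m n) ⟨
    - ((suc m ℕ.+ suc n) ×′ 1#)      ≈⟨ -‿cong (×-homo-+ 1# (suc m) (suc n)) ⟩
    - (suc m ×′ 1# + suc n ×′ 1#)    ≈⟨ ⁻¹-∙-comm _ _ ⟨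
    - (suc m ×′ 1#) - (suc n ×′ 1#)  ∎

  fromℤ-* : ∀ i j → fromℤ (i ℤ.* j) ≈ fromℤ i * fromℤ j
  fromℤ-* i j = begin
    fromℤ (i ℤ.* j)
      ≈⟨ fromℤ-◃ (ℤ.sign i Sign.* ℤ.sign j) (ℤ.∣ i ∣ ℕ.* ℤ.∣ j ∣) ⟩
    sign (ℤ.sign i Sign.* ℤ.sign j) * ((ℤ.∣ i ∣ ℕ.* ℤ.∣ j ∣) ×′ 1#)
      ≈⟨ *-cong (sign-* (ℤ.sign i) (ℤ.sign j)) (×1-homo-* ℤ.∣ i ∣ ℤ.∣ j ∣) ⟩
    (sign (ℤ.sign i) * sign (ℤ.sign j)) * ((ℤ.∣ i ∣ ×′ 1#) * (ℤ.∣ j ∣ ×′ 1#))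
      ≈⟨ *-interchange _ _ _ _ ⟩
    (sign (ℤ.sign i) * (ℤ.∣ i ∣ ×′ 1#)) * (sign (ℤ.sign j) * (ℤ.∣ j ∣ ×′ 1#))
      ≈⟨ *-cong (fromℤ-sign i) (fromℤ-sign j) ⟨
    fromℤ i * fromℤ j
      ∎

  fromℤ-neg : ∀ i → fromℤ (ℤ.- i) ≈ - fromℤ i
  fromℤ-neg (+ zero)  = sym -0#≈0#
  fromℤ-neg (+ suc n) = refl
  fromℤ-neg -[1+ n ]  = sym (-‿involutive _)

  fromℤ-homomorphism : ℤ.+-*-rawRing -Raw-AlmostCommutative⟶ fromCommutativeRing K
  fromℤ-homomorphism = record
    { ⟦_⟧ = fromℤ ; +-homo = fromℤ-+ ; *-homo = fromℤ-* ; -‿homo = fromℤ-neg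
    ; 0-homo = refl ; 1-homo = refl }

  private
    fromℤ-≟ : ∀ i j → Maybe (fromℤ i ≈ fromℤ j)
    fromℤ-≟ i j with i ℤ.≟ j
    ... | yes ≡.refl = just refl
    ... | no _       = nothing

  open Algebra.Solver.Ring ℤ.+-*-rawRing (fromCommutativeRing K) fromℤ-homomorphism fromℤ-≟ public

module Transversals where

  -- reps contains exactly one element of P from every ∼-class meeting P, so its length
  -- counts these classes; QuotientSize and HasDegree are statements of this shape.
  record Transversal {A : Set} (P : Pred A 0ℓ) (_∼_ : A → A → Set) : Set where
    field
      reps     : List A
      members  : All P reps
      distinct : AllPairs (λ x y → ¬ x ∼ y) reps
      covers   : ∀ {x} → P x → Any (x ∼_) reps

  open Transversal

  module _ {A B : Set} {P : Pred A 0ℓ} {_∼_ : A → A → Set} {Q : Pred B 0ℓ} {_≈_ : B → B → Set} where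

    map : (f : A → B) →
          (∀ {x} → P x → Q (f x)) →
          (∀ {x y} → f x ≈ f y → x ∼ y) →
          (∀ {z} → Q z → Σ[ x ∈ A ] P x × (∀ {y} → x ∼ y → z ≈ f y)) →
          Transversal P _∼_ → Transversal Q _≈_
    map f pres reflects lifts T = record
      { reps     = List.map f (reps T)
      ; members  = All.map⁺ (All.map pres (members T))
      ; distinct = AllPairs.map⁺ (AllPairs.map (_∘ reflects) (distinct T))
      ; covers   = λ qz → let x , px , h = lifts qz in Any.map⁺ (Any.map h (covers T px))
      }

  module _ {A : Set} {P P₁ P₂ : Pred A 0ℓ} {_∼_ : A → A → Set} where

    union : (∀ {x} → P₁ x → P x) → (∀ {x} → P₂ x → P x) → (∀ {x} → P x → P₁ x ⊎ P₂ x) →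
            (∀ {x y} → P₁ x → P₂ y → ¬ x ∼ y) →
            Transversal P₁ _∼_ → Transversal P₂ _∼_ → Transversal P _∼_
    union P₁⊆P P₂⊆P split apart T₁ T₂ = record
      { reps     = reps T₁ ++ reps T₂
      ; members  = All.++⁺ (All.map P₁⊆P (members T₁)) (All.map P₂⊆P (members T₂))
      ; distinct = AllPairs.++⁺ (distinct T₁) (distinct T₂)
                     (All.map (λ p₁ → All.map (apart p₁) (members T₂)) (members T₁))
      ; covers   = λ px → cover (split px)
      }
      where
      cover : ∀ {x} → P₁ x ⊎ P₂ x → Any (x ∼_) (reps T₁ ++ reps T₂)
      cover (inj₁ p₁) = Any.++⁺ˡ (covers T₁ p₁)
      cover (inj₂ p₂) = Any.++⁺ʳ (reps T₁) (covers T₂ p₂)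

  module _ {A B C : Set} {P₁ : Pred A 0ℓ} {P₂ : Pred B 0ℓ} {P : Pred C 0ℓ}
           {_∼₁_ : A → A → Set} {_∼₂_ : B → B → Set} {_∼_ : C → C → Set} where

    cartesianProduct : (f : A → B → C) →
      (∀ {x y} → P₁ x → P₂ y → P (f x y)) →
      (∀ {x x′ y y′} → P₁ x → P₁ x′ → P₂ y → P₂ y′ → f x y ∼ f x′ y′ → x ∼₁ x′) →
      (∀ {x y y′} → P₁ x → f x y ∼ f x y′ → y ∼₂ y′) →
      (∀ {z} → P z → Σ[ x ∈ A ] P₁ x × (∀ {x′} → x ∼₁ x′ →
                      Σ[ y ∈ B ] P₂ y × (∀ {y′} → y ∼₂ y′ → z ∼ f x′ y′))) →
      Transversal P₁ _∼₁_ → Transversal P₂ _∼₂_ → Transversal P _∼_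
    cartesianProduct f pres reflects₁ reflects₂ lifts T₁ T₂ = record
      { reps     = cartesianProductWith f (reps T₁) (reps T₂)
      ; members  = All.cartesianProductWith⁺ (≡.setoid A) (≡.setoid B) f (reps T₁) (reps T₂)
                     (λ x∈ y∈ → pres (All.lookup (members T₁) x∈) (All.lookup (members T₂) y∈))
      ; distinct = distinct′ (members T₁) (distinct T₁)
      ; covers   = λ pz → let x , p₁ , h = lifts pz in cover h (covers T₁ p₁)
      }
      where
      distinct′ : ∀ {xs} → All P₁ xs → AllPairs (λ x x′ → ¬ x ∼₁ x′) xs →
                  AllPairs (λ z w → ¬ z ∼ w) (cartesianProductWith f xs (reps T₂))
      distinct′ {[]}     []         []                 = []
      distinct′ {x ∷ xs} (p₁ ∷ p₁s) (x≁xs ∷ distinct₁) = AllPairs.++⁺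
        (AllPairs.map⁺ (AllPairs.map (_∘ reflects₂ p₁) (distinct T₂)))
        (distinct′ p₁s distinct₁)
        (All.map⁺ (All.map (λ p₂ → All.cartesianProductWith⁺ (≡.setoid A) (≡.setoid B) f xs (reps T₂)
           (λ x′∈ y′∈ → All.lookup x≁xs x′∈ ∘ reflects₁ p₁ (All.lookup p₁s x′∈) p₂ (All.lookup (members T₂) y′∈)))
           (members T₂)))
      cover : ∀ {z x xs} → (∀ {x′} → x ∼₁ x′ → Σ[ y ∈ B ] P₂ y × (∀ {y′} → y ∼₂ y′ → z ∼ f x′ y′)) →
              Any (x ∼₁_) xs → Any (z ∼_) (cartesianProductWith f xs (reps T₂))
      cover h (here x∼x′)  = let y , p₂ , g = h x∼x′ in Any.++⁺ˡ (Any.map⁺ (Any.map g (covers T₂ p₂)))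
      cover h (there x∼xs) = Any.++⁺ʳ _ (cover h x∼xs)

  module _ {A : Set} {P Q : Pred A 0ℓ} {_∼_ : A → A → Set} where

    filter : (Q? : U.Decidable Q) → (∀ {x} → Q x → P x) → (∀ {x y} → Q x → x ∼ y → Q y) →
             Transversal P _∼_ → Transversal Q _∼_
    filter Q? Q⊆P Q-resp T = record
      { reps     = List.filter Q? (reps T)
      ; members  = All.all-filter Q? (reps T)
      ; distinct = AllPairs.filter⁺ Q? (distinct T)
      ; covers   = λ qx → [ id , (λ ¬q → contradiction (Q-resp qx (Any.lookup-result (covers T (Q⊆P qx)))) ¬q) ]′
                            (Any.filter⁺ Q? (covers T (Q⊆P qx)))
      }

  length-cartesianProductWith : ∀ {A B C : Set} (f : A → B → C) xs ys →
                                length (cartesianProductWith f xs ys) ≡ length xs ℕ.* length ys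
  length-cartesianProductWith f []       ys = ≡.refl
  length-cartesianProductWith f (x ∷ xs) ys = begin
    length (List.map (f x) ys ++ cartesianProductWith f xs ys)
      ≡⟨ length-++ (List.map (f x) ys) ⟩
    length (List.map (f x) ys) ℕ.+ length (cartesianProductWith f xs ys)
      ≡⟨ cong₂ ℕ._+_ (length-map (f x) ys) (length-cartesianProductWith f xs ys) ⟩
    length ys ℕ.+ length xs ℕ.* length ys
      ∎
    where open ≡-Reasoning

  module _ {A : Set} {P : Pred A 0ℓ} (P? : U.Decidable P) where

    length-filter-∁ : ∀ {xs} → AllPairs (λ x y → ¬ (P x × P y)) xs → Any P xs →
                      suc (length (List.filter (¬? ∘ P?) xs)) ≡ length xs
    length-filter-∁ {x ∷ xs} (x⊥xs ∷ _) (here px) with P? x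
    ... | yes _  = cong (suc ∘ length) (filter-all (¬? ∘ P?) (All.map (λ ¬both py → ¬both (px , py)) x⊥xs))
    ... | no ¬px = contradiction px ¬px
    length-filter-∁ {x ∷ xs} (x⊥xs ∷ ⊥xs) (there pxs) with P? x
    ... | yes px = contradiction (px , Any.lookup-result pxs) (proj₁ (All.lookupAny x⊥xs pxs))
    ... | no _   = cong suc (length-filter-∁ ⊥xs pxs)

open Transversals

count-step : ∀ {q u D X Y} → suc u ≡ q → q ℕ.* D ℕ.+ Y ≡ X →
             q ℕ.* (u ℕ.* X ℕ.+ q ℕ.* D) ℕ.+ q ℕ.* Y ≡ (q ℕ.* q) ℕ.* X
count-step {q} {u} {D} {X} {Y} suc-u≡q qD+Y≡X = begin
  q ℕ.* (u ℕ.* X ℕ.+ q ℕ.* D) ℕ.+ q ℕ.* Y    ≡⟨ regroup q u X D Y ⟩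
  q ℕ.* (u ℕ.* X) ℕ.+ q ℕ.* (q ℕ.* D ℕ.+ Y)  ≡⟨ cong (λ n → q ℕ.* (u ℕ.* X) ℕ.+ q ℕ.* n) qD+Y≡X ⟩
  q ℕ.* (u ℕ.* X) ℕ.+ q ℕ.* X                ≡⟨ factor q u X ⟩
  q ℕ.* (suc u ℕ.* X)                        ≡⟨ cong (λ n → q ℕ.* (n ℕ.* X)) suc-u≡q ⟩
  q ℕ.* (q ℕ.* X)                            ≡⟨ ℕ.*-assoc q q X ⟨
  (q ℕ.* q) ℕ.* X                            ∎
  where
  open ≡-Reasoning
  regroup : ∀ q u X D Y → q ℕ.* (u ℕ.* X ℕ.+ q ℕ.* D) ℕ.+ q ℕ.* Y ≡ q ℕ.* (u ℕ.* X) ℕ.+ q ℕ.* (q ℕ.* D ℕ.+ Y)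
  regroup = solve-∀
  factor : ∀ q u X → q ℕ.* (u ℕ.* X) ℕ.+ q ℕ.* X ≡ q ℕ.* (suc u ℕ.* X)
  factor = solve-∀

^-square : ∀ q m → (q ℕ.* q) ^ m ≡ q ^ m ℕ.* q ^ m
^-square q zero    = ≡.refl
^-square q (suc m) = ≡.trans (cong (q ℕ.* q ℕ.*_) (^-square q m)) (interchange q q (q ^ m) (q ^ m))
  where open import Algebra.Properties.CommutativeSemigroup ℕ.*-commutativeSemigroup using (interchange)

degree-formula : ∀ e₁ {q D} → 0 < q → q ℕ.* D ℕ.+ q ^ (e₁ ℕ.+ suc e₁) ≡ (q ℕ.* q) ^ (e₁ ℕ.+ suc e₁) →
                 D ≡ q ^ (4 ℕ.* suc e₁ ∸ 3) ∸ q ^ (2 ℕ.* suc e₁ ∸ 2)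
degree-formula e₁ {q} {D} q>0 count = begin
  D                              ≡⟨ ℕ.m+n∸n≡m D (q ^ s) ⟨
  D ℕ.+ q ^ s ∸ q ^ s            ≡⟨ cong (_∸ q ^ s) D+q^s≡q^[s+1+s] ⟩
  q ^ (s ℕ.+ suc s) ∸ q ^ s      ≡⟨ cong₂ (λ m n → q ^ m ∸ q ^ n) 4e-3≡s+1+s 2e-2≡s ⟨
  q ^ (4 ℕ.* suc e₁ ∸ 3) ∸ q ^ (2 ℕ.* suc e₁ ∸ 2)  ∎
  where
  open ≡-Reasoning
  s = e₁ ℕ.+ e₁
  D+q^s≡q^[s+1+s] : D ℕ.+ q ^ s ≡ q ^ (s ℕ.+ suc s)
  D+q^s≡q^[s+1+s] = ℕ.*-cancelˡ-≡ _ _ q {{ℕ.>-nonZero q>0}} (begin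
    q ℕ.* (D ℕ.+ q ^ s)              ≡⟨ ℕ.*-distribˡ-+ q D (q ^ s) ⟩
    q ℕ.* D ℕ.+ q ^ suc s            ≡⟨ ≡.subst (λ n → q ℕ.* D ℕ.+ q ^ n ≡ (q ℕ.* q) ^ n) (ℕ.+-suc e₁ e₁) count ⟩
    (q ℕ.* q) ^ suc s                ≡⟨ ^-square q (suc s) ⟩
    q ^ suc s ℕ.* q ^ suc s          ≡⟨ ℕ.*-assoc q (q ^ s) (q ^ suc s) ⟩
    q ℕ.* (q ^ s ℕ.* q ^ suc s)      ≡⟨ cong (q ℕ.*_) (ℕ.^-distribˡ-+-* q s (suc s)) ⟨
    q ℕ.* q ^ (s ℕ.+ suc s)          ∎)
  regroup-4e : ∀ x → 4 ℕ.* suc x ≡ 3 ℕ.+ ((x ℕ.+ x) ℕ.+ suc (x ℕ.+ x))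
  regroup-4e = solve-∀
  regroup-2e : ∀ x → 2 ℕ.* suc x ≡ 2 ℕ.+ (x ℕ.+ x)
  regroup-2e = solve-∀
  4e-3≡s+1+s : 4 ℕ.* suc e₁ ∸ 3 ≡ s ℕ.+ suc s
  4e-3≡s+1+s = ≡.trans (cong (_∸ 3) (regroup-4e e₁)) (ℕ.m+n∸m≡n 3 (s ℕ.+ suc s))
  2e-2≡s : 2 ℕ.* suc e₁ ∸ 2 ≡ s
  2e-2≡s = ≡.trans (cong (_∸ 2) (regroup-2e e₁)) (ℕ.m+n∸m≡n 2 s)

∀-by-punchIn : ∀ {m} {P : Fin (suc m) → Set} (k : Fin (suc m)) → P k → (∀ j → P (punchIn k j)) → ∀ j → P j
∀-by-punchIn {P = P} k Pk P-punchIn j with k Fin.≟ j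
... | yes ≡.refl = Pk
... | no k≢j     = ≡.subst P (Fin.punchIn-punchOut k≢j) (P-punchIn (punchOut k≢j))

↑ˡ≢↑ʳ : ∀ {m n} (i : Fin m) (j : Fin n) → i ↑ˡ n ≢ m ↑ʳ j
↑ˡ≢↑ʳ {m} {n} i j eq with ≡.trans (≡.sym (Fin.splitAt-↑ˡ m i n)) (≡.trans (cong (splitAt m) eq) (Fin.splitAt-↑ʳ m n j))
... | ()

module Units (K : CommutativeRing 0ℓ 0ℓ) where
  open CommutativeRing K
  open IntegerSolver K using (solve; _:*_; _:-_; :-_; _:=_; con)
  open import Algebra.Properties.Group +-group using () renaming (x∙y⁻¹≈ε⇒x≈y to x-y≈0⇒x≈y)
  open import Relation.Binary.Reasoning.Setoid setoid

  IsUnit-resp : ∀ {x y} → x ≈ y → IsUnit K x → IsUnit K y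
  IsUnit-resp x≈y (x⁻¹ , xx⁻¹≈1) = x⁻¹ , trans (*-congʳ (sym x≈y)) xx⁻¹≈1

  IsUnit-1 : IsUnit K 1#
  IsUnit-1 = 1# , *-identityˡ 1#

  IsUnit-* : ∀ {x y} → IsUnit K x → IsUnit K y → IsUnit K (x * y)
  IsUnit-* {x} {y} (x⁻¹ , xx⁻¹≈1) (y⁻¹ , yy⁻¹≈1) = x⁻¹ * y⁻¹ , (begin
    (x * y) * (x⁻¹ * y⁻¹)  ≈⟨ solve 4 (λ x y a b → (x :* y) :* (a :* b) := (x :* a) :* (y :* b)) refl x y x⁻¹ y⁻¹ ⟩
    (x * x⁻¹) * (y * y⁻¹)  ≈⟨ *-cong xx⁻¹≈1 yy⁻¹≈1 ⟩
    1# * 1#                ≈⟨ *-identityˡ 1# ⟩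
    1#                     ∎)

  IsUnit-neg : ∀ {x} → IsUnit K x → IsUnit K (- x)
  IsUnit-neg {x} (x⁻¹ , xx⁻¹≈1) = - x⁻¹ , trans (solve 2 (λ x y → (:- x) :* (:- y) := x :* y) refl x x⁻¹) xx⁻¹≈1

  unit*x≈0⇒x≈0 : ∀ {u x} → IsUnit K u → u * x ≈ 0# → x ≈ 0#
  unit*x≈0⇒x≈0 {u} {x} (u⁻¹ , uu⁻¹≈1) ux≈0 = begin
    x               ≈⟨ *-identityˡ x ⟨
    1# * x          ≈⟨ *-congʳ uu⁻¹≈1 ⟨
    (u * u⁻¹) * x   ≈⟨ solve 3 (λ u v x → (u :* v) :* x := v :* (u :* x)) refl u u⁻¹ x ⟩
    u⁻¹ * (u * x)   ≈⟨ *-congˡ ux≈0 ⟩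
    u⁻¹ * 0#        ≈⟨ zeroʳ u⁻¹ ⟩
    0#              ∎

  u≈μu⇒μ≈1 : ∀ {u μ} → IsUnit K u → u ≈ μ * u → μ ≈ 1#
  u≈μu⇒μ≈1 {u} {μ} unit u≈μu = x-y≈0⇒x≈y μ 1# (unit*x≈0⇒x≈0 unit (begin
    u * (μ - 1#)   ≈⟨ solve 2 (λ u μ → u :* (μ :- con (+ 1)) := μ :* u :- u) refl u μ ⟩
    μ * u - u      ≈⟨ +-congʳ u≈μu ⟨
    u - u          ≈⟨ -‿inverseʳ u ⟩
    0#             ∎))

module Basis (K : CommutativeRing 0ℓ 0ℓ) where
  open CommutativeRing K hiding (zero)

  basis : ∀ {n} → Fin n → Tuple K n
  basis k j with j Fin.≟ k
  ... | yes _ = 1#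
  ... | no _  = 0#

  basis-same : ∀ {n} (k : Fin n) → basis k k ≈ 1#
  basis-same k with k Fin.≟ k
  ... | yes _  = refl
  ... | no k≢k = contradiction ≡.refl k≢k

  basis-other : ∀ {n} {k j : Fin n} → j ≢ k → basis k j ≈ 0#
  basis-other {k = k} {j} j≢k with j Fin.≟ k
  ... | yes j≡k = contradiction j≡k j≢k
  ... | no _    = refl

module LocalRing (K : CommutativeRing 0ℓ 0ℓ) (_≟_ : Decidable (CommutativeRing._≈_ K))
                 (finite : IsFinite K) (r : CommutativeRing.Carrier K)
                 (unique : UniqueNonTrivialIdeal K (⟨_⟩ K r)) where
  open CommutativeRing K hiding (zero)
  open Units K
  open IntegerSolver K using (solve; _:+_; _:*_; _:-_; :-_; _:=_; con)
  open Basis K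
  open import Relation.Binary.Reasoning.Setoid setoid
  open import Algebra.Properties.Ring ring using (-1*x≈-x)
  open import Algebra.Properties.Group +-group using ()
    renaming (x∙y⁻¹≈ε⇒x≈y to x-y≈0⇒x≈y; x≈y⇒x∙y⁻¹≈ε to x≈y⇒x-y≈0; ∙-cancelˡ to +-cancelˡ)
  open import Data.Vec.Functional.Relation.Binary.Equality.Setoid setoid using (_≋_) public

  J : Carrier → Set
  J = ⟨_⟩ K r

  private
    module J = IsIdeal (proj₁ (proj₁ unique))

  J-resp : ∀ {x y} → x ≈ y → J x → J y
  J-resp = J.resp

  J-0 : J 0#
  J-0 = J.zero∈

  J-+ : ∀ {x y} → J x → J y → J (x + y)
  J-+ = J.+-closed

  J-* : ∀ a {x} → J x → J (a * x)
  J-* = J.*-closed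

  J-*ʳ : ∀ a {x} → J x → J (x * a)
  J-*ʳ a jx = J-resp (*-comm a _) (J-* a jx)

  J-neg : ∀ {x} → J x → J (- x)
  J-neg {x} jx = J-resp (-1*x≈-x x) (J-* (- 1#) jx)

  J-- : ∀ {x y} → J x → J y → J (x - y)
  J-- jx jy = J-+ jx (J-neg jy)

  r∈J : J r
  r∈J = 1# , sym (*-identityˡ r)

  r≉0 : ¬ r ≈ 0#
  r≉0 r≈0 = proj₁ (proj₂ (proj₁ unique)) λ x →
    (λ (y , x≈yr) → trans x≈yr (trans (*-congˡ r≈0) (zeroʳ y))) , λ x≈0 → 0# , trans x≈0 (sym (zeroˡ r))

  J⇒¬unit : ∀ {x} → J x → ¬ IsUnit K x
  J⇒¬unit {x} jx (x⁻¹ , xx⁻¹≈1) = proj₂ (proj₂ (proj₁ unique)) λ y →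
    J-resp (trans (*-congˡ (trans (*-comm x⁻¹ x) xx⁻¹≈1)) (*-identityʳ y)) (J-* y (J-* x⁻¹ jx))

  1∉J : ¬ J 1#
  1∉J j = J⇒¬unit j IsUnit-1

  principal-isIdeal : ∀ x → IsIdeal K (⟨_⟩ K x)
  principal-isIdeal x = record
    { resp     = λ { p (y , q) → y , trans (sym p) q }
    ; zero∈    = 0# , sym (zeroˡ x)
    ; +-closed = λ { (a , p) (b , q) → a + b , trans (+-cong p q) (sym (distribʳ x a b)) }
    ; *-closed = λ { a (y , p) → a * y , trans (*-congˡ p) (sym (*-assoc a y x)) }
    }

  principal-nonTrivial : ∀ {x} → ¬ x ≈ 0# → ¬ IsUnit K x → IsNonTrivialIdeal K (⟨_⟩ K x)
  principal-nonTrivial {x} x≉0 ¬unit = principal-isIdeal x ,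
    (λ zero → x≉0 (proj₁ (zero x) (1# , sym (*-identityˡ x)))) ,
    (λ whole → let y , 1≈yx = whole 1# in ¬unit (y , trans (*-comm x y) (sym 1≈yx)))

  ¬unit⇒J : ∀ {x} → ¬ IsUnit K x → J x
  ¬unit⇒J {x} ¬unit with x ≟ 0#
  ... | yes x≈0 = J-resp (sym x≈0) J-0
  ... | no x≉0  = proj₁ (proj₂ unique _ (principal-nonTrivial x≉0 ¬unit) x) (1# , sym (*-identityˡ x))

  IsUnit? : ∀ x → Dec (IsUnit K x)
  IsUnit? x = map′ (λ p → Any.lookup p , Any.lookup-result p)
                   (λ (y , xy≈1) → Any.map (λ y≈z → trans (*-congˡ (sym y≈z)) xy≈1) (proj₂ finite y))
                   (Any.any? (λ y → (x * y) ≟ 1#) (proj₁ finite))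

  J? : ∀ x → Dec (J x)
  J? x = map′ ¬unit⇒J J⇒¬unit (¬? (IsUnit? x))

  ¬J⇒unit : ∀ {x} → ¬ J x → IsUnit K x
  ¬J⇒unit {x} ¬jx = decidable-stable (IsUnit? x) (λ ¬unit → ¬jx (¬unit⇒J ¬unit))

  1+J⊆units : ∀ {μ} → J (μ - 1#) → IsUnit K μ
  1+J⊆units {μ} j = ¬J⇒unit λ jμ →
    1∉J (J-resp (solve 1 (λ μ → μ :- (μ :- con (+ 1)) := con (+ 1)) refl μ) (J-- jμ j))

  *r≈0⇒J : ∀ {x} → x * r ≈ 0# → J x
  *r≈0⇒J {x} xr≈0 = ¬unit⇒J λ unit → r≉0 (unit*x≈0⇒x≈0 unit xr≈0)

  -- If r² ≉ 0 then ⟨r²⟩ is non-trivial, hence equal to J ∋ r; but then r ≈ w r² gives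
  -- (1 - w r) r ≈ 0 with 1 - w r a unit.
  r*r≈0 : r * r ≈ 0#
  r*r≈0 with (r * r) ≟ 0#
  ... | yes rr≈0 = rr≈0
  ... | no rr≉0 = contradiction (unit*x≈0⇒x≈0 (1+J⊆units (J-resp -wr≈[1-wr]-1 (J-neg (J-* w r∈J)))) r[1-wr]≈0) r≉0
    where
    r∈⟨rr⟩ : ⟨_⟩ K (r * r) r
    r∈⟨rr⟩ = proj₂ (proj₂ unique _ (principal-nonTrivial rr≉0 (J⇒¬unit (J-* r r∈J))) r) r∈J
    w = proj₁ r∈⟨rr⟩
    -wr≈[1-wr]-1 : - (w * r) ≈ (1# - w * r) - 1#
    -wr≈[1-wr]-1 = solve 2 (λ w r → :- (w :* r) := (con (+ 1) :- w :* r) :- con (+ 1)) refl w r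
    r[1-wr]≈0 : (1# - w * r) * r ≈ 0#
    r[1-wr]≈0 = begin
      (1# - w * r) * r           ≈⟨ solve 2 (λ w r → (con (+ 1) :- w :* r) :* r := r :- w :* (r :* r)) refl w r ⟩
      r - w * (r * r)            ≈⟨ +-congʳ (proj₂ r∈⟨rr⟩) ⟩
      w * (r * r) - w * (r * r)  ≈⟨ -‿inverseʳ _ ⟩
      0#                         ∎

  J*J≈0 : ∀ {x y} → J x → J y → x * y ≈ 0#
  J*J≈0 {x} {y} (a , x≈ar) (b , y≈br) = begin
    x * y              ≈⟨ *-cong x≈ar y≈br ⟩
    (a * r) * (b * r)  ≈⟨ solve 3 (λ a b r → (a :* r) :* (b :* r) := (a :* b) :* (r :* r)) refl a b r ⟩
    (a * b) * (r * r)  ≈⟨ *-congˡ r*r≈0 ⟩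
    (a * b) * 0#       ≈⟨ zeroʳ _ ⟩
    0#                 ∎

  1+J-fixes-J : ∀ {μ x} → J (μ - 1#) → J x → μ * x ≈ x
  1+J-fixes-J {μ} {x} jμ jx = begin
    μ * x               ≈⟨ solve 2 (λ μ x → μ :* x := (μ :- con (+ 1)) :* x :+ x) refl μ x ⟩
    (μ - 1#) * x + x    ≈⟨ +-congʳ (J*J≈0 jμ jx) ⟩
    0# + x              ≈⟨ +-identityˡ x ⟩
    x                   ∎

  *r-cong : ∀ {x y} → J (x - y) → x * r ≈ y * r
  *r-cong {x} {y} j = x-y≈0⇒x≈y _ _ (begin
    x * r - y * r   ≈⟨ solve 3 (λ x y r → x :* r :- y :* r := (x :- y) :* r) refl x y r ⟩
    (x - y) * r     ≈⟨ J*J≈0 j r∈J ⟩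
    0#              ∎)

  *r-injective : ∀ {x y} → x * r ≈ y * r → J (x - y)
  *r-injective {x} {y} xr≈yr = *r≈0⇒J (begin
    (x - y) * r     ≈⟨ solve 3 (λ x y r → (x :- y) :* r := x :* r :- y :* r) refl x y r ⟩
    x * r - y * r   ≈⟨ x≈y⇒x-y≈0 xr≈yr ⟩
    0#              ∎)

  scaled-by-1+J : ∀ {x u} → IsUnit K u → J (x - u) → ∃ λ μ → J (μ - 1#) × x ≈ μ * u
  scaled-by-1+J {x} {u} (u⁻¹ , uu⁻¹≈1) j = x * u⁻¹ , J-resp μ-1≈ (J-*ʳ u⁻¹ j) , (begin
    x                 ≈⟨ *-identityʳ x ⟨
    x * 1#            ≈⟨ *-congˡ uu⁻¹≈1 ⟨
    x * (u * u⁻¹)     ≈⟨ solve 3 (λ x u v → x :* (u :* v) := (x :* v) :* u) refl x u u⁻¹ ⟩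
    (x * u⁻¹) * u     ∎)
    where
    μ-1≈ : (x - u) * u⁻¹ ≈ x * u⁻¹ - 1#
    μ-1≈ = begin
      (x - u) * u⁻¹         ≈⟨ solve 3 (λ x u v → (x :- u) :* v := x :* v :- u :* v) refl x u u⁻¹ ⟩
      x * u⁻¹ - u * u⁻¹     ≈⟨ +-congˡ (-‿cong uu⁻¹≈1) ⟩
      x * u⁻¹ - 1#          ∎

  -- Scaling by 1 + J: a unit fixes r exactly when it lies in 1 + J, so this is the
  -- freedom left in a neighbour once it is normalised to ⟨a , b⟩ ≈ r.
  _∼_ : ∀ {m} → Tuple K m → Tuple K m → Set
  g ∼ h = ∃ λ μ → J (μ - 1#) × ∀ j → g j ≈ μ * h j


  ¬J-resp-≡J : ∀ {x y} → ¬ J x → J (x - y) → ¬ J y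
  ¬J-resp-≡J {x} {y} ¬jx jx-y jy = ¬jx (J-resp (solve 2 (λ x y → (x :- y) :+ y := x) refl x y) (J-+ jx-y jy))

  module Residues (residues : Transversal (λ _ → ⊤) (λ x y → J (x - y))) where
    open Transversal

    q : ℕ
    q = length (reps residues)

    ideal-elements : Transversal J _≈_
    ideal-elements = map (_* r) (λ {v} _ → v , refl) *r-injective
      (λ (x , z≈xr) → x , tt , λ x≡y → trans z≈xr (*r-cong x≡y))
      residues

    elements : Transversal (λ _ → ⊤) _≈_
    elements = cartesianProduct _+_ (λ _ _ → tt) reflects₁ (λ _ → +-cancelˡ _ _ _)
      (λ {z} _ → z , tt , λ {u} z≡u → z - u , z≡u , λ z-u≈j →
        trans (solve 2 (λ z u → z := u :+ (z :- u)) refl z u) (+-congˡ z-u≈j))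
      residues ideal-elements
      where
      reflects₁ : ∀ {u u′ j j′} → ⊤ → ⊤ → J j → J j′ → u + j ≈ u′ + j′ → J (u - u′)
      reflects₁ {u} {u′} {j} {j′} _ _ jj jj′ e = J-resp
        (solve 4 (λ u u′ j j′ → ((u :+ j) :- (u′ :+ j′)) :+ (j′ :- j) := u :- u′) refl u u′ j j′)
        (J-+ (J-resp (sym (x≈y⇒x-y≈0 e)) J-0) (J-- jj′ jj))

    length-elements : length (reps elements) ≡ q ℕ.* q
    length-elements = ≡.trans (length-cartesianProductWith _+_ (reps residues) (reps ideal-elements))
                              (cong (q ℕ.*_) (length-map (_* r) (reps residues)))

    unit-residues : Transversal (¬_ ∘ J) (λ x y → J (x - y))
    unit-residues = filter (¬? ∘ J?) (λ _ → tt) ¬J-resp-≡J residues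

    length-unit-residues : suc (length (reps unit-residues)) ≡ q
    length-unit-residues = length-filter-∁ J?
      (AllPairs.map (λ x≢y (jx , jy) → x≢y (J-- jx jy)) (distinct residues))
      (Any.map (λ {x} j → J-resp (solve 1 (λ x → :- (con (+ 0) :- x) := x) refl x) (J-neg j))
               (covers residues {0#} tt))

    tuples : ∀ m → Transversal (λ _ → ⊤) (_≋_ {m})
    tuples zero    = record { reps = []ᵥ ∷ [] ; members = tt ∷ [] ; distinct = [] ∷ [] ; covers = λ _ → here λ () }
    tuples (suc m) = cartesianProduct _∷ᵥ_ (λ _ _ → tt) (λ _ _ _ _ e → e zero) (λ _ e → e ∘ suc)
      (λ {z} _ → head z , tt , λ z₀≈x → tail z , tt , λ z≋y → λ { zero → z₀≈x ; (suc j) → z≋y j })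
      elements (tuples m)

    length-tuples : ∀ m → length (reps (tuples m)) ≡ (q ℕ.* q) ^ m
    length-tuples zero    = ≡.refl
    length-tuples (suc m) = ≡.trans (length-cartesianProductWith _∷ᵥ_ (reps elements) (reps (tuples m)))
                                    (cong₂ ℕ._*_ length-elements (length-tuples m))

    unit-headed : ∀ m → Transversal (λ (g : Tuple K (suc m)) → ¬ J (head g)) _∼_
    unit-headed m = cartesianProduct _∷ᵥ_ (λ ¬ju _ → ¬ju) reflects₁ reflects₂ lifts unit-residues (tuples m)
      where
      reflects₁ : ∀ {u u′} {g h : Tuple K m} → ¬ J u → ¬ J u′ → ⊤ → ⊤ → (u ∷ᵥ g) ∼ (u′ ∷ᵥ h) → J (u - u′)
      reflects₁ {u} {u′} _ _ _ _ (μ , j , e) = J-resp (begin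
        (μ - 1#) * u′   ≈⟨ solve 2 (λ μ u → (μ :- con (+ 1)) :* u := μ :* u :- u) refl μ u′ ⟩
        μ * u′ - u′     ≈⟨ +-congʳ (e zero) ⟨
        u - u′          ∎) (J-*ʳ u′ j)
      reflects₂ : ∀ {u} {g h : Tuple K m} → ¬ J u → (u ∷ᵥ g) ∼ (u ∷ᵥ h) → g ≋ h
      reflects₂ ¬ju (μ , _ , e) i =
        trans (e (suc i)) (trans (*-congʳ (u≈μu⇒μ≈1 (¬J⇒unit ¬ju) (e zero))) (*-identityˡ _))
      lifts : ∀ {z : Tuple K (suc m)} → ¬ J (head z) → ∃ λ x → ¬ J x × ∀ {u} → J (x - u) →
                ∃ λ g → ⊤ × ∀ {h} → g ≋ h → z ∼ (u ∷ᵥ h)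
      lifts {z} ¬jz₀ = head z , ¬jz₀ , λ {u} z₀≡u →
        let μ , jμ , z₀≈μu = scaled-by-1+J (¬J⇒unit (¬J-resp-≡J ¬jz₀ z₀≡u)) z₀≡u
            ν , μν≈1 = 1+J⊆units jμ
        in (λ i → ν * z (suc i)) , tt , λ {h} g≋h → μ , jμ , λ
             { zero    → z₀≈μu
             ; (suc i) → begin
                 z (suc i)               ≈⟨ *-identityˡ _ ⟨
                 1# * z (suc i)          ≈⟨ *-congʳ μν≈1 ⟨
                 (μ * ν) * z (suc i)     ≈⟨ *-assoc μ ν _ ⟩
                 μ * (ν * z (suc i))     ≈⟨ *-congˡ (g≋h i) ⟩
                 μ * h i                 ∎ }

    ideal-headed : ∀ {m} → Transversal (InV' K) (_∼_ {m}) →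
                   Transversal (λ (g : Tuple K (suc m)) → J (head g) × InV' K (tail g)) _∼_
    ideal-headed T = cartesianProduct _∷ᵥ_ _,_
      (λ _ jx′ _ _ (μ , jμ , e) → trans (e zero) (1+J-fixes-J jμ jx′))
      (λ _ (μ , jμ , e) → μ , jμ , e ∘ suc)
      (λ {z} (jz₀ , v) → head z , jz₀ , λ z₀≈x → tail z , v , λ (μ , jμ , e) → μ , jμ , λ
         { zero    → trans z₀≈x (sym (1+J-fixes-J jμ (J-resp z₀≈x jz₀)))
         ; (suc i) → e i })
      ideal-elements T

    -- A unit head can be scaled onto a unit residue, leaving an arbitrary tail; a head in J
    -- is fixed by 1 + J, so the tail is unimodular and only determined up to ∼.
    unimodular : ∀ m → Transversal (InV' K) (_∼_ {m})
    unimodular zero    = record { reps = [] ; members = [] ; distinct = [] ; covers = λ () }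
    unimodular (suc m) = union (λ ¬j → zero , ¬J⇒unit ¬j) (λ (_ , i , u) → suc i , u) split
      (λ ¬jx (jy , _) (μ , _ , e) → ¬jx (J-resp (sym (e zero)) (J-* μ jy)))
      (unit-headed m) (ideal-headed (unimodular m))
      where
      split : ∀ {g : Tuple K (suc m)} → InV' K g → ¬ J (head g) ⊎ (J (head g) × InV' K (tail g))
      split {g} v with J? (head g)
      split (i , u)     | no ¬j = inj₁ ¬j
      split (zero , u)  | yes j = contradiction u (J⇒¬unit j)
      split (suc i , u) | yes j = inj₂ (j , i , u)

    unimodular-count : ∀ m → q ℕ.* length (reps (unimodular m)) ℕ.+ q ^ m ≡ (q ℕ.* q) ^ m
    unimodular-count zero    = cong (ℕ._+ 1) (ℕ.*-zeroʳ q)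
    unimodular-count (suc m) = ≡.trans
      (cong (λ n → q ℕ.* n ℕ.+ q ^ suc m)
            (≡.trans (length-++ (reps (unit-headed m))) (cong₂ ℕ._+_ length-unit-headed length-ideal-headed)))
      (count-step length-unit-residues (unimodular-count m))
      where
      u = length (reps unit-residues)
      D = length (reps (unimodular m))
      length-unit-headed : length (reps (unit-headed m)) ≡ u ℕ.* (q ℕ.* q) ^ m
      length-unit-headed = ≡.trans (length-cartesianProductWith _∷ᵥ_ (reps unit-residues) (reps (tuples m)))
                                   (cong (u ℕ.*_) (length-tuples m))
      length-ideal-headed : length (reps (ideal-headed (unimodular m))) ≡ q ℕ.* D
      length-ideal-headed = ≡.trans (length-cartesianProductWith _∷ᵥ_ (reps ideal-elements) (reps (unimodular m)))
                                    (cong (ℕ._* D) (length-map (_* r) (reps residues)))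

  module Lift {m : ℕ} (F : Tuple K (suc m) → Carrier)
              (F-cong : ∀ {x y} → x ≋ y → F x ≈ F y)
              (F-+ : ∀ x y → F (λ j → x j + y j) ≈ F x + F y)
              (F-* : ∀ s x → F (λ j → s * x j) ≈ s * F x)
              (unit-coordinate : ∃ λ k → IsUnit K (F (basis k))) where

    private
      k = proj₁ unit-coordinate
      c = F (basis k)
      c⁻¹ = proj₁ (proj₂ unit-coordinate)
      cc⁻¹≈1 : c * c⁻¹ ≈ 1#
      cc⁻¹≈1 = proj₂ (proj₂ unit-coordinate)

    insertAt-linear : ∀ h t → insertAt h k t ≋ (λ j → t * basis k j + insertAt h k 0# j)
    insertAt-linear h t = ∀-by-punchIn k
      (begin
        insertAt h k t k                  ≡⟨ insertAt-lookup h k t ⟩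
        t                                 ≈⟨ solve 1 (λ t → t := t :* con (+ 1) :+ con (+ 0)) refl t ⟩
        t * 1# + 0#                       ≈⟨ +-cong (*-congˡ (basis-same k)) (reflexive (insertAt-lookup h k 0#)) ⟨
        t * basis k k + insertAt h k 0# k ∎)
      (λ j → begin
        insertAt h k t (punchIn k j)      ≡⟨ insertAt-punchIn h k t j ⟩
        h j                               ≈⟨ solve 2 (λ t x → x := t :* con (+ 0) :+ x) refl t (h j) ⟩
        t * 0# + h j                      ≈⟨ +-cong (*-congˡ (basis-other (Fin.punchInᵢ≢i k j)))
                                                    (reflexive (insertAt-punchIn h k 0# j)) ⟨
        t * basis k (punchIn k j) + insertAt h k 0# (punchIn k j) ∎)

    F-insertAt : ∀ h t → F (insertAt h k t) ≈ t * c + F (insertAt h k 0#)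
    F-insertAt h t = trans (F-cong (insertAt-linear h t)) (trans (F-+ _ _) (+-congʳ (F-* t (basis k))))

    pivot : Tuple K m → Carrier
    pivot h = c⁻¹ * (r - F (insertAt h k 0#))

    lift : Tuple K m → Tuple K (suc m)
    lift h = insertAt h k (pivot h)

    pivot-unique : ∀ {h t} → F (insertAt h k t) ≈ r → t ≈ pivot h
    pivot-unique {h} {t} F≈r = begin
      t                          ≈⟨ *-identityˡ t ⟨
      1# * t                     ≈⟨ *-congʳ cc⁻¹≈1 ⟨
      (c * c⁻¹) * t              ≈⟨ solve 4 (λ c d t x → (c :* d) :* t := d :* ((t :* c :+ x) :- x)) refl c c⁻¹ t x ⟩
      c⁻¹ * ((t * c + x) - x)    ≈⟨ *-congˡ (+-congʳ (trans (sym (F-insertAt h t)) F≈r)) ⟩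
      pivot h                    ∎
      where x = F (insertAt h k 0#)

    F-lift : ∀ h → F (lift h) ≈ r
    F-lift h = begin
      F (lift h)                 ≈⟨ F-insertAt h (pivot h) ⟩
      pivot h * c + x            ≈⟨ solve 4 (λ c d r x → d :* (r :- x) :* c :+ x := (c :* d) :* (r :- x) :+ x) refl c c⁻¹ r x ⟩
      (c * c⁻¹) * (r - x) + x    ≈⟨ +-congʳ (*-congʳ cc⁻¹≈1) ⟩
      1# * (r - x) + x           ≈⟨ solve 2 (λ r x → con (+ 1) :* (r :- x) :+ x := r) refl r x ⟩
      r                          ∎
      where x = F (insertAt h k 0#)

    lift-removeAt : ∀ {b} → F b ≈ r → b ≋ lift (removeAt b k)
    lift-removeAt {b} Fb≈r = ∀-by-punchIn k
      (trans (pivot-unique (trans (F-cong (reflexive ∘ insertAt-removeAt b k)) Fb≈r))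
             (reflexive (≡.sym (insertAt-lookup (removeAt b k) k _))))
      (λ j → reflexive (≡.sym (insertAt-punchIn (removeAt b k) k _ j)))

    insertAt-scale : ∀ {μ h h′ t t′} → h ≋ (λ j → μ * h′ j) → t ≈ μ * t′ →
                     insertAt h k t ≋ (λ j → μ * insertAt h′ k t′ j)
    insertAt-scale {μ} {h} {h′} {t} {t′} h≋μh′ t≈μt′ = ∀-by-punchIn k
      (trans (reflexive (insertAt-lookup h k t))
             (trans t≈μt′ (*-congˡ (reflexive (≡.sym (insertAt-lookup h′ k t′))))))
      (λ j → trans (reflexive (insertAt-punchIn h k t j))
                   (trans (h≋μh′ j) (*-congˡ (reflexive (≡.sym (insertAt-punchIn h′ k t′ j))))))

    lift-scale : ∀ {μ h h′} → J (μ - 1#) → h ≋ (λ j → μ * h′ j) → lift h ≋ (λ j → μ * lift h′ j)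
    lift-scale {μ} {h} {h′} jμ h≋μh′ = insertAt-scale h≋μh′ (begin
      c⁻¹ * (r - F (insertAt h k 0#))           ≈⟨ *-congˡ (+-cong (1+J-fixes-J jμ r∈J) (-‿cong F≈μF′)) ⟨
      c⁻¹ * (μ * r - μ * F (insertAt h′ k 0#))  ≈⟨ solve 4 (λ d μ r x → d :* (μ :* r :- μ :* x) := μ :* (d :* (r :- x))) refl c⁻¹ μ r _ ⟩
      μ * pivot h′                              ∎)
      where
      F≈μF′ : μ * F (insertAt h′ k 0#) ≈ F (insertAt h k 0#)
      F≈μF′ = sym (trans (F-cong (insertAt-scale h≋μh′ (sym (zeroʳ μ)))) (F-* μ _))

    insertAt-J : ∀ {h t} → (∀ j → J (h j)) → J t → ∀ j → J (insertAt h k t j)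
    insertAt-J {h} {t} h∈J t∈J = ∀-by-punchIn k
      (J-resp (reflexive (≡.sym (insertAt-lookup h k t))) t∈J)
      (λ j → J-resp (reflexive (≡.sym (insertAt-punchIn h k t j))) (h∈J j))

    F-J : ∀ {x} → (∀ j → J (x j)) → J (F x)
    F-J {x} x∈J = J-resp (trans (sym (F-* r y)) (F-cong λ j → trans (*-comm r (y j)) (sym (proj₂ (x∈J j)))))
                         (J-*ʳ (F y) r∈J)
      where y = λ j → proj₁ (x∈J j)

    lift-J : ∀ {h} → (∀ j → J (h j)) → ∀ j → J (lift h j)
    lift-J h∈J = insertAt-J h∈J (J-* c⁻¹ (J-- r∈J (F-J (insertAt-J h∈J J-0))))

    removeAt-unimodular : ∀ {b} → F b ≈ r → InV' K b → InV' K (removeAt b k)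
    removeAt-unimodular {b} Fb≈r (i , b-i-unit) =
      let j , ¬J = Fin.¬∀⟶∃¬ m _ (J? ∘ removeAt b k) not-all-J in j , ¬J⇒unit ¬J
      where
      not-all-J : ¬ (∀ j → J (removeAt b k j))
      not-all-J all-J = J⇒¬unit (J-resp (sym (lift-removeAt Fb≈r i)) (lift-J all-J i)) b-i-unit

    normalise : ∀ {b} → InV' K b → J (F b) → ¬ F b ≈ 0# →
                ∃ λ y → IsUnit K y × ∃ λ b′ → InV' K b′ × F b′ ≈ r × b ≋ (λ j → y * b′ j)
    normalise {b} (i , b-i-unit) (y , Fb≈yr) Fb≉0 =
      y , y-unit , b′ , (i , IsUnit-* (y , trans (*-comm y⁻¹ y) yy⁻¹≈1) b-i-unit) , Fb′≈r , b≋yb′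
      where
      y-unit : IsUnit K y
      y-unit = ¬J⇒unit λ jy → Fb≉0 (trans Fb≈yr (J*J≈0 jy r∈J))
      y⁻¹ = proj₁ y-unit
      yy⁻¹≈1 : y * y⁻¹ ≈ 1#
      yy⁻¹≈1 = proj₂ y-unit
      b′ : Tuple K (suc m)
      b′ j = y⁻¹ * b j
      b≋yb′ : b ≋ (λ j → y * b′ j)
      b≋yb′ j = begin
        b j                ≈⟨ *-identityˡ (b j) ⟨
        1# * b j           ≈⟨ *-congʳ yy⁻¹≈1 ⟨
        (y * y⁻¹) * b j    ≈⟨ *-assoc y y⁻¹ (b j) ⟩
        y * b′ j           ∎
      Fb′≈r : F b′ ≈ r
      Fb′≈r = begin
        F b′               ≈⟨ F-* y⁻¹ b ⟩
        y⁻¹ * F b          ≈⟨ *-congˡ Fb≈yr ⟩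
        y⁻¹ * (y * r)      ≈⟨ solve 3 (λ a y r → a :* (y :* r) := (y :* a) :* r) refl y⁻¹ y r ⟩
        (y * y⁻¹) * r      ≈⟨ *-congʳ yy⁻¹≈1 ⟩
        1# * r             ≈⟨ *-identityˡ r ⟩
        r                  ∎

    neighbours : Transversal (InV' K) (_∼_ {m}) →
                 Transversal (λ b → InV' K b × J (F b) × ¬ F b ≈ 0#) (Equiv K)
    neighbours = map lift
      (λ {h} (j , unit) → (punchIn k j , IsUnit-resp (sym (lift-punchIn h j)) unit) ,
                          J-resp (sym (F-lift h)) r∈J , λ F≈0 → r≉0 (trans (sym (F-lift h)) F≈0))
      reflects lifts
      where
      lift-punchIn : ∀ h j → lift h (punchIn k j) ≈ h j
      lift-punchIn h j = reflexive (insertAt-punchIn h k (pivot h) j)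
      reflects : ∀ {h h′} → Equiv K (lift h) (lift h′) → h ∼ h′
      reflects {h} {h′} (l , _ , e) = l , *r-injective lr≈1r , λ j →
        trans (sym (lift-punchIn h j)) (trans (e (punchIn k j)) (*-congˡ (lift-punchIn h′ j)))
        where
        lr≈1r : l * r ≈ 1# * r
        lr≈1r = begin
          l * r                     ≈⟨ *-congˡ (F-lift h′) ⟨
          l * F (lift h′)           ≈⟨ F-* l (lift h′) ⟨
          F (λ j → l * lift h′ j)   ≈⟨ F-cong e ⟨
          F (lift h)                ≈⟨ F-lift h ⟩
          r                         ≈⟨ *-identityˡ r ⟨
          1# * r                    ∎
      lifts : ∀ {b} → InV' K b × J (F b) × ¬ F b ≈ 0# →
              ∃ λ h → InV' K h × ∀ {h′} → h ∼ h′ → Equiv K b (lift h′)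
      lifts {b} (b-unimodular , Fb∈J , Fb≉0) =
        let y , y-unit , b′ , b′-unimodular , Fb′≈r , b≋yb′ = normalise b-unimodular Fb∈J Fb≉0
        in removeAt b′ k , removeAt-unimodular Fb′≈r b′-unimodular ,
           λ {h′} (μ , jμ , h≋μh′) → y * μ , IsUnit-* y-unit (1+J⊆units jμ) , λ j → begin
             b j                          ≈⟨ b≋yb′ j ⟩
             y * b′ j                     ≈⟨ *-congˡ (lift-removeAt Fb′≈r j) ⟩
             y * lift (removeAt b′ k) j   ≈⟨ *-congˡ (lift-scale jμ h≋μh′ j) ⟩
             y * (μ * lift h′ j)          ≈⟨ *-assoc y μ _ ⟨
             (y * μ) * lift h′ j          ∎

module SymplecticForm (K : CommutativeRing 0ℓ 0ℓ) (e : ℕ) (a : Tuple K (e ℕ.+ e)) where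
  open CommutativeRing K hiding (zero)
  open Basis K
  open Units K
  open IntegerSolver K using (solve; _:+_; _:*_; _:-_; :-_; _:=_; con)
  open import Algebra.Properties.CommutativeMonoid.Sum +-commutativeMonoid
    using (sum; sum-cong-≋; ∑-distrib-+; sum-remove; sum-replicate-zero)
  open import Algebra.Properties.Semiring.Sum semiring using (*-distribˡ-sum)
  open import Relation.Binary.Reasoning.Setoid setoid

  ∑≡sum : ∀ n (f : Tuple K n) → ∑ K n f ≡ sum f
  ∑≡sum zero    f = ≡.refl
  ∑≡sum (suc n) f = cong (λ s → f zero + s) (∑≡sum n (f ∘ suc))

  sum-single : ∀ {n} (t : Tuple K n) i → (∀ j → j ≢ i → t j ≈ 0#) → sum t ≈ t i
  sum-single {suc n} t i t≈0 = begin
    sum t                                  ≈⟨ sum-remove t ⟩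
    t i + sum {n} (λ j → t (punchIn i j))  ≈⟨ +-congˡ (sum-cong-≋ (λ j → t≈0 (punchIn i j) (Fin.punchInᵢ≢i i j))) ⟩
    t i + sum {n} (λ _ → 0#)               ≈⟨ +-congˡ (sum-replicate-zero n) ⟩
    t i + 0#                               ≈⟨ +-identityʳ (t i) ⟩
    t i                                    ∎

  term : Tuple K (e ℕ.+ e) → Tuple K e
  term b i = a (i ↑ˡ e) * b (e ↑ʳ i) - a (e ↑ʳ i) * b (i ↑ˡ e)

  form≈sum : ∀ b → form K e a b ≈ sum (term b)
  form≈sum b = reflexive (∑≡sum e (term b))

  form-cong : ∀ {x y} → (∀ j → x j ≈ y j) → form K e a x ≈ form K e a y
  form-cong {x} {y} x≈y = begin
    form K e a x    ≈⟨ form≈sum x ⟩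
    sum (term x)    ≈⟨ sum-cong-≋ (λ i → +-cong (*-congˡ (x≈y (e ↑ʳ i))) (-‿cong (*-congˡ (x≈y (i ↑ˡ e))))) ⟩
    sum (term y)    ≈⟨ form≈sum y ⟨
    form K e a y    ∎

  form-+ : ∀ x y → form K e a (λ j → x j + y j) ≈ form K e a x + form K e a y
  form-+ x y = begin
    form K e a (λ j → x j + y j)          ≈⟨ form≈sum (λ j → x j + y j) ⟩
    sum (term (λ j → x j + y j))          ≈⟨ sum-cong-≋ (λ i → solve 6 (λ a a′ x x′ y y′ →
                                               a :* (x′ :+ y′) :- a′ :* (x :+ y) := (a :* x′ :- a′ :* x) :+ (a :* y′ :- a′ :* y))
                                               refl (a (i ↑ˡ e)) (a (e ↑ʳ i)) (x (i ↑ˡ e)) (x (e ↑ʳ i)) (y (i ↑ˡ e)) (y (e ↑ʳ i))) ⟩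
    sum (λ i → term x i + term y i)       ≈⟨ ∑-distrib-+ (term x) (term y) ⟩
    sum (term x) + sum (term y)           ≈⟨ +-cong (form≈sum x) (form≈sum y) ⟨
    form K e a x + form K e a y           ∎

  form-* : ∀ s x → form K e a (λ j → s * x j) ≈ s * form K e a x
  form-* s x = begin
    form K e a (λ j → s * x j)            ≈⟨ form≈sum (λ j → s * x j) ⟩
    sum (term (λ j → s * x j))            ≈⟨ sum-cong-≋ (λ i → solve 5 (λ a a′ s x x′ →
                                               a :* (s :* x′) :- a′ :* (s :* x) := s :* (a :* x′ :- a′ :* x))
                                               refl (a (i ↑ˡ e)) (a (e ↑ʳ i)) s (x (i ↑ˡ e)) (x (e ↑ʳ i))) ⟩
    sum (λ i → s * term x i)              ≈⟨ *-distribˡ-sum s (term x) ⟨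
    s * sum (term x)                      ≈⟨ *-congˡ (form≈sum x) ⟨
    s * form K e a x                      ∎

  form-basis-↑ʳ : ∀ i → form K e a (basis (e ↑ʳ i)) ≈ a (i ↑ˡ e)
  form-basis-↑ʳ i = trans (form≈sum (basis (e ↑ʳ i))) (trans (sum-single (term (basis (e ↑ʳ i))) i vanishes) at-i)
    where
    at-i : term (basis (e ↑ʳ i)) i ≈ a (i ↑ˡ e)
    at-i = trans (+-cong (*-congˡ (basis-same (e ↑ʳ i))) (-‿cong (*-congˡ (basis-other (↑ˡ≢↑ʳ i i)))))
                 (solve 2 (λ x y → x :* con (+ 1) :- y :* con (+ 0) := x) refl _ _)
    vanishes : ∀ t → t ≢ i → term (basis (e ↑ʳ i)) t ≈ 0#
    vanishes t t≢i = trans (+-cong (*-congˡ (basis-other (t≢i ∘ Fin.↑ʳ-injective e t i)))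
                                   (-‿cong (*-congˡ (basis-other (↑ˡ≢↑ʳ t i)))))
                           (solve 2 (λ x y → x :* con (+ 0) :- y :* con (+ 0) := con (+ 0)) refl _ _)

  form-basis-↑ˡ : ∀ i → form K e a (basis (i ↑ˡ e)) ≈ - a (e ↑ʳ i)
  form-basis-↑ˡ i = trans (form≈sum (basis (i ↑ˡ e))) (trans (sum-single (term (basis (i ↑ˡ e))) i vanishes) at-i)
    where
    at-i : term (basis (i ↑ˡ e)) i ≈ - a (e ↑ʳ i)
    at-i = trans (+-cong (*-congˡ (basis-other (↑ˡ≢↑ʳ i i ∘ ≡.sym))) (-‿cong (*-congˡ (basis-same (i ↑ˡ e)))))
                 (solve 2 (λ x y → x :* con (+ 0) :- y :* con (+ 1) := :- y) refl _ _)
    vanishes : ∀ t → t ≢ i → term (basis (i ↑ˡ e)) t ≈ 0#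
    vanishes t t≢i = trans (+-cong (*-congˡ (basis-other (↑ˡ≢↑ʳ i t ∘ ≡.sym)))
                                   (-‿cong (*-congˡ (basis-other (t≢i ∘ Fin.↑ˡ-injective e t i)))))
                           (solve 2 (λ x y → x :* con (+ 0) :- y :* con (+ 0) := con (+ 0)) refl _ _)

  unit-coefficient : InV' K a → ∃ λ k → IsUnit K (form K e a (basis k))
  unit-coefficient (i , unit) = coefficient (splitAt e i) (≡.subst (IsUnit K ∘ a) (≡.sym (Fin.join-splitAt e e i)) unit)
    where
    coefficient : ∀ s → IsUnit K (a (Fin.join e e s)) → ∃ λ k → IsUnit K (form K e a (basis k))
    coefficient (inj₁ i) unit = e ↑ʳ i , IsUnit-resp (sym (form-basis-↑ʳ i)) unit
    coefficient (inj₂ i) unit = i ↑ˡ e , IsUnit-resp (sym (form-basis-↑ˡ i)) (IsUnit-neg unit)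

open import Data.Nat using (_*_)

proposition3p3 : (e : ℕ) → e ≥ 2 →
    (K : CommutativeRing 0ℓ 0ℓ) → Decidable (CommutativeRing._≈_ K) → IsFinite K →
    (r : CommutativeRing.Carrier K) → UniqueNonTrivialIdeal K (⟨_⟩ K r) →
    (q : ℕ) → IsPrimePower q → QuotientSize K (⟨_⟩ K r) q →
    IsRegularOfDegree K (⟨_⟩ K r) e (q ^ (4 * e ∸ 3) ∸ q ^ (2 * e ∸ 2))
proposition3p3 (suc e₁) _ K _≟_ finite r unique q _ (Rl , |Rl|≡q , Rl-distinct , Rl-covers) a a∈V′ =
  reps N , length-N , members N , distinct N , λ b b∈V′ b∼a → covers N (b∈V′ , b∼a)
  where
  open CommutativeRing K using (_-_)
  open LocalRing K _≟_ finite r unique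
  open Transversal
  residues : Transversal (λ _ → ⊤) (λ x y → J (x - y))
  residues = record { reps = Rl ; members = All.universal _ Rl ; distinct = Rl-distinct ; covers = λ _ → Rl-covers _ }
  open Residues residues using (unimodular; unimodular-count; length-unit-residues)
  open SymplecticForm K (suc e₁) a
  open Lift (form K (suc e₁) a) form-cong form-+ form-* (unit-coefficient a∈V′) using (lift; neighbours)
  m = e₁ ℕ.+ suc e₁
  N = neighbours (unimodular m)
  length-N : length (reps N) ≡ q ^ (4 * suc e₁ ∸ 3) ∸ q ^ (2 * suc e₁ ∸ 2)
  length-N = ≡.trans (length-map lift (reps (unimodular m))) (degree-formula e₁ q>0 count)
    where
    q>0 : 0 < q
    q>0 = ≡.subst (0 <_) (≡.trans length-unit-residues |Rl|≡q) (ℕ.s≤s ℕ.z≤n)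
    count : q * length (reps (unimodular m)) ℕ.+ q ^ m ≡ (q * q) ^ m
    count = ≡.subst (λ q → q * length (reps (unimodular m)) ℕ.+ q ^ m ≡ (q * q) ^ m) |Rl|≡q (unimodular-count m)
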